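{- For all positive integers $n,r,l$, if a connected ordered graph $G^<$ is $n$-good, then the ordered graphs $G^< + S^<_{1,r}$, $G^< + S^<_{l,1}$, $S^<_{l,1}+G^<$, and $S^<_{1,r}+G^<$ are also $n$-good.
   Context: An ordered graph on $N$ vertices is a graph with vertex set $[N]=\{1,\dots,N\}$ ordered by the usual order of integers. An ordered graph $G^<$ on $[n]$ is an ordered subgraph of an ordered graph $H^<$ on $[N]$ if there is a map $\phi:[n]\to[N]$ with $\phi(i)<\phi(j)$ whenever $i<j$ such that $\{\phi(i),\phi(j)\}$ is an edge of $H^<$ whenever $\{i,j\}$ is an edge of $G^<$. $K^<_N$ is the complete ordered graph on $[N]$. The ordered Ramsey number $r_<(G^<,H^<)$ is the least $N$ such that every red-blue coloring of the edges of $K^<_N$ contains a red copy of $G^<$ or a blue copy of $H^<$ as an ordered subgraph. A connected ordered graph $G^<$ on $m$ vertices is $n$-good if $r_<(G^<,K^<_n)=(m-1)(n-1)+1$. The ordered star $S^<_{l,r}$ is the ordered graph on $l+r-1$ vertices in which the $l$-th vertex is adjacent to all other vertices and there are no other edges. For ordered graphs $G^<$ on $m$ vertices and $H^<$ on $n$ vertices, the join $G^<+H^<$ is the ordered graph on $m+n-1$ vertices obtained by placing $H^<$ after $G^<$ and identifying the leftmost vertex of $H^<$ with the rightmost vertex of $G^<$ (vertices $1,\dots,m$ carry $G^<$, vertices $m,\dots,m+n-1$ carry $H^<$). -}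

module Defs where

open import Data.Nat using (ℕ; zero; suc; _+_; _*_; _∸_; _<_; _≤_; _<?_; _≡ᵇ_)
open import Data.Fin using (Fin; toℕ; fromℕ<)
open import Data.Bool using (Bool; true; false; _∨_)
open import Data.Product using (Σ; _×_)
open import Data.Sum using (_⊎_)
open import Relation.Nullary using (¬_; yes; no)
open import Relation.Binary.PropositionalEquality using (_≡_)

-- The unordered pair {i,j} with i < j is an edge iff  adj i j ≡ true;
-- the values of adj at pairs with i ≥ j are irrelevant (never consulted).
record OGraph (m : ℕ) : Set where
  field
    adj : Fin m → Fin m → Bool
open OGraph public

Edge : ∀ {m} → OGraph m → Fin m → Fin m → Set
Edge G i j = (toℕ i < toℕ j) × (adj G i j ≡ true)

Adjacent : ∀ {m} → OGraph m → Fin m → Fin m → Set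
Adjacent G i j = Edge G i j ⊎ Edge G j i

data Reach {m} (G : OGraph m) : Fin m → Fin m → Set where
  here : ∀ {i} → Reach G i i
  step : ∀ {i j k} → Adjacent G i j → Reach G j k → Reach G i k

Connected : ∀ {m} → OGraph m → Set
Connected {m} G = (0 < m) × (∀ i j → Reach G i j)

K : (n : ℕ) → OGraph n
K n = record { adj = λ _ _ → true }

-- ordered star S_{l,r} on l + r - 1 vertices: the l-th vertex (index l-1) is the centre
Star : (l r : ℕ) → OGraph (l + r ∸ 1)
Star l r = record { adj = λ i j → (toℕ i ≡ᵇ (l ∸ 1)) ∨ (toℕ j ≡ᵇ (l ∸ 1)) }

adjℕ : ∀ {m} → OGraph m → ℕ → ℕ → Bool
adjℕ {m} G a b with a <? m | b <? m
... | yes p | yes q = adj G (fromℕ< p) (fromℕ< q)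
... | _     | _     = false

-- join G + H on m + k - 1 vertices: G on 0..m-1, H on m-1..m+k-2
-- (the last vertex of G is identified with the first vertex of H)
join : ∀ {m k} → OGraph m → OGraph k → OGraph (m + k ∸ 1)
join {m} {k} G H = record { adj = λ i j → a (toℕ i) (toℕ j) }
  where
  a : ℕ → ℕ → Bool
  a x y with x <? m | y <? m
  ... | yes _ | yes _ = adjℕ G x y
  ... | _     | _     with (m ∸ 1) Data.Nat.≤? x | (m ∸ 1) Data.Nat.≤? y
  ...   | yes _ | yes _ = adjℕ H (x ∸ (m ∸ 1)) (y ∸ (m ∸ 1))
  ...   | _     | _     = false

-- red/blue colourings of the edges of K_N (colour of {i,j}, i < j, is c i j)
data Colour : Set where
  red blue : Colour

Colouring : ℕ → Set
Colouring N = Fin N → Fin N → Colour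

CopyIn : ∀ {m} → (N : ℕ) → Colouring N → Colour → OGraph m → Set
CopyIn {m} N c col G =
  Σ (Fin m → Fin N) λ φ →
    (∀ i j → toℕ i < toℕ j → toℕ (φ i) < toℕ (φ j)) ×
    (∀ i j → Edge G i j → c (φ i) (φ j) ≡ col)

Arrows : ∀ {m k} → ℕ → OGraph m → OGraph k → Set
Arrows N G H = (c : Colouring N) → CopyIn N c red G ⊎ CopyIn N c blue H

IsOrderedRamsey : ∀ {m k} → OGraph m → OGraph k → ℕ → Set
IsOrderedRamsey G H R = Arrows R G H × (∀ N → N < R → ¬ Arrows N G H)

NGood : ∀ {m} → ℕ → OGraph m → Set
NGood {m} n G = Connected G × IsOrderedRamsey G (K n) ((m ∸ 1) * (n ∸ 1) + 1)

module Submission where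

-- Lower bound: colour K_N red inside consecutive blocks of m − 1 vertices and blue between
-- them.  A red copy of a connected graph on m vertices would lie inside one block, and a blue
-- K_n needs n blocks, so N ≤ (m − 1)(n − 1) does not suffice; only the upper bound is at stake.
--
-- Upper bound: let the star add a new vertices to G at its first or last vertex v, and colour
-- K_N with N = (m − 1 + a)(n − 1) + 1.  Call x extendable if a red copy of the star fits with x
-- in the place of v.  If at most (m − 1)(n − 1) vertices are extendable, at least a(n − 1) + 1
-- are not, and each of these has fewer than a red neighbours among them on one side: for a
-- star centred at v this is the definition, otherwise the extreme one of a such neighbours
-- would itself be extendable.  Greedily choosing vertices and discarding their red neighbours
-- then yields a blue K_n.  If instead (m − 1)(n − 1) + 1 vertices are extendable, n-goodness
-- of G gives a blue K_n or a red G among them, and a red G extends at the image of v.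

open import Defs
open import Data.Bool using (true; false)
open import Data.Bool.Properties using (T-≡; T-∨)
open import Data.Empty using (⊥-elim)
open import Data.Fin using (Fin; toℕ; fromℕ; fromℕ<; inject₁; splitAt; _↑ˡ_; _↑ʳ_)
  renaming (zero to fzero; suc to fsuc)
open import Data.Fin.Properties
  using (toℕ-fromℕ<; fromℕ<-toℕ; toℕ-injective; toℕ-↑ˡ; toℕ-↑ʳ; splitAt⁻¹-↑ˡ; splitAt⁻¹-↑ʳ;
         toℕ-fromℕ; ¬Fin0; toℕ-inject₁; toℕ<n)
open import Data.List using (List; []; _∷_; [_]; length; filter; allFin; reverse)
open import Data.List.Properties
  using (unfold-reverse; filter-++; filter-all; length-++; length-reverse; length-tabulate)
open import Data.List.Membership.Propositional using (_∈_; lose)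
open import Data.List.Membership.Propositional.Properties using (∈-filter⁻; ∈-allFin)
open import Data.List.Relation.Binary.Sublist.Propositional using (_⊆_; _∷ʳ_; _∷_; ⊆-refl; ⊆-trans)
open import Data.List.Relation.Binary.Sublist.Propositional.Properties
  using (filter⁺; filter-⊆; length-mono-≤; All-resp-⊆; []⊆-universal; ∷ˡ⁻)
open import Data.List.Relation.Unary.All as All using (All; []; _∷_)
import Data.List.Relation.Unary.All.Properties as Allₚ
open import Data.List.Relation.Unary.AllPairs using (AllPairs; []; _∷_)
import Data.List.Relation.Unary.AllPairs.Properties as AllPairsₚ
open import Data.List.Relation.Unary.Any as Any using (Any; here; there; any?)
open import Data.Nat using (ℕ; zero; suc; _+_; _*_; _∸_; _<_; _≤_; _<?_; _≤?_; _≟_; _/_; pred; NonZero;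
  z≤n; s≤s; s≤s⁻¹)
open import Data.Nat.DivMod using (/-monoˡ-≤; m/n≡1+[m∸n]/n; m<n*o⇒m/o<n)
open import Data.Nat.Properties
open import Data.Nat.Tactic.RingSolver using (solve-∀)
open import Data.Product using (Σ; _×_; _,_; proj₁; proj₂)
open import Data.Sum as Sum using (_⊎_; inj₁; inj₂)
open import Data.Vec.Functional as Vector using (Vector; _++_)
open import Data.Vec.Functional.Properties using (lookup-++ˡ; lookup-++ʳ; lookup-++-<)
open import Function using (_∘_; flip; id)
open import Function.Bundles using (Equivalence)
open import Relation.Binary.Definitions using (tri<; tri≈; tri>)
open import Relation.Binary.PropositionalEquality hiding ([_]; J)
open import Relation.Nullary using (¬_; Dec; yes; no; ¬?)
open import Relation.Nullary.Decidable using (_×-dec_)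
open import Relation.Unary using (Decidable)

-- Increasing maps, copies and counting

Increasing : ∀ {k N} → (Fin k → Fin N) → Set
Increasing f = ∀ i j → toℕ i < toℕ j → toℕ (f i) < toℕ (f j)

IsCopy : ∀ {m N} → Colouring N → Colour → OGraph m → (Fin m → Fin N) → Set
IsCopy c col G f = Increasing f × (∀ i j → Edge G i j → c (f i) (f j) ≡ col)

copy-along-increasing : ∀ {m N N′} {c : Colouring N} {col} {G : OGraph m} (σ : Fin N′ → Fin N) →
  Increasing σ → CopyIn N′ (λ i j → c (σ i) (σ j)) col G → CopyIn N c col G
copy-along-increasing σ σ-incr (φ , φ-incr , φ-col) =
  (λ i → σ (φ i)) , (λ i j i<j → σ-incr _ _ (φ-incr i j i<j)) , φ-col

module _ {A : Set} where

  prefix-sequence : {R : A → A → Set} (xs : List A) → AllPairs R xs → (k : ℕ) → k ≤ length xs →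
    Σ (Vector A k) λ f → (∀ i j → toℕ i < toℕ j → R (f i) (f j)) × (∀ i → f i ∈ xs)
  prefix-sequence xs _ zero _ = (λ ()) , (λ ()) , (λ ())
  prefix-sequence {R} (x ∷ xs) (Rx ∷ Rxs) (suc k) (s≤s k≤) with prefix-sequence xs Rxs k k≤
  ... | f , f-incr , f∈ = (x Vector.∷ f) , incr , ∈
    where
    incr : ∀ i j → toℕ i < toℕ j → R ((x Vector.∷ f) i) ((x Vector.∷ f) j)
    incr fzero    (fsuc j) _         = All.lookup Rx (f∈ j)
    incr (fsuc i) (fsuc j) (s≤s i<j) = f-incr i j i<j
    ∈ : ∀ i → (x Vector.∷ f) i ∈ x ∷ xs
    ∈ fzero    = here refl
    ∈ (fsuc i) = there (f∈ i)

  module _ {P : A → Set} (P? : Decidable P) where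

    length-filter-split : ∀ xs → length xs ≡ length (filter P? xs) + length (filter (¬? ∘ P?) xs)
    length-filter-split [] = refl
    length-filter-split (x ∷ xs) with P? x
    ... | yes _ = cong suc (length-filter-split xs)
    ... | no _  = trans (cong suc (length-filter-split xs)) (sym (+-suc _ _))

    length-filter-mono : ∀ {xs ys} → xs ⊆ ys → length (filter P? xs) ≤ length (filter P? ys)
    length-filter-mono xs⊆ys = length-mono-≤ (filter⁺ P? P? (λ { refl p → p }) xs⊆ys)

    length-≤-filter : ∀ {xs ys} → All P xs → xs ⊆ ys → length xs ≤ length (filter P? ys)
    length-≤-filter {xs} {ys} all-P xs⊆ys =
      subst (_≤ length (filter P? ys)) (cong length (filter-all P? all-P)) (length-filter-mono xs⊆ys)

  greedy-independent : {P R : A → A → Set} (R? : ∀ x → Decidable (R x)) (d n : ℕ) (ys : List A) →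
    AllPairs P ys → All (λ x → length (filter (R? x) ys) < d) ys → d * n + 1 ≤ length ys →
    Σ (List A) λ zs → zs ⊆ ys × suc n ≤ length zs × AllPairs (λ a b → P a b × ¬ R a b) zs
  greedy-independent R? d n [] _ _ long with ≤-trans (m≤n+m 1 (d * n)) long
  ... | ()
  greedy-independent R? d zero (x ∷ ys) _ _ _ = x ∷ [] , refl ∷ []⊆-universal ys , s≤s z≤n , [] ∷ []
  greedy-independent R? d (suc n) (x ∷ ys) (Px ∷ Pys) (x-few ∷ ys-few) long
    with greedy-independent R? d n rest (AllPairsₚ.filter⁺ _ Pys) rest-few rest-long
    where
    rest : List A
    rest = filter (¬? ∘ R? x) ys
    rest-few : All (λ z → length (filter (R? z) rest) < d) rest
    rest-few = Allₚ.filter⁺ (¬? ∘ R? x)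
      (All.map (λ {z} z-few → ≤-<-trans (length-filter-mono (R? z) (filter-⊆ _ ys))
        (≤-<-trans (length-filter-mono (R? z) (x ∷ʳ ⊆-refl)) z-few)) ys-few)
    rest-long : d * n + 1 ≤ length rest
    rest-long = +-cancelˡ-≤ a (d * n + 1) (length rest) (begin
        a + (d * n + 1)     ≡⟨ trans (cong (a +_) (+-comm (d * n) 1)) (+-suc a (d * n)) ⟩
        suc a + d * n       ≤⟨ +-monoˡ-≤ (d * n) a<d ⟩
        d + d * n           ≡⟨ sym (*-suc d n) ⟩
        d * suc n           ≤⟨ s≤s⁻¹ (subst (_≤ suc (length ys)) (+-comm (d * suc n) 1) long) ⟩
        length ys           ≡⟨ length-filter-split (R? x) ys ⟩
        a + length rest     ∎)
      where
      open ≤-Reasoning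
      a : ℕ
      a = length (filter (R? x) ys)
      a<d : a < d
      a<d = ≤-<-trans (length-filter-mono (R? x) (x ∷ʳ ⊆-refl)) x-few
  ... | zs , zs⊆ , long-zs , indep-zs =
    x ∷ zs , refl ∷ ⊆-trans zs⊆ (filter-⊆ _ ys) , s≤s long-zs ,
    All-resp-⊆ zs⊆ (All.zip (Allₚ.filter⁺ (¬? ∘ R? x) Px , Allₚ.all-filter (¬? ∘ R? x) ys)) ∷ indep-zs

  All-reverse : {P : A → Set} {xs : List A} → All P xs → All P (reverse xs)
  All-reverse {xs = []} [] = []
  All-reverse {xs = x ∷ xs} (px ∷ pxs) rewrite unfold-reverse x xs = Allₚ.++⁺ (All-reverse pxs) (px ∷ [])

  AllPairs-reverse : {R : A → A → Set} {xs : List A} → AllPairs R xs → AllPairs (flip R) (reverse xs)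
  AllPairs-reverse {xs = []} [] = []
  AllPairs-reverse {xs = x ∷ xs} (Rx ∷ Rxs) rewrite unfold-reverse x xs =
    AllPairsₚ.++⁺ (AllPairs-reverse Rxs) ([] ∷ []) (All-reverse (All.map (λ r → r ∷ []) Rx))

  length-filter-reverse : {P : A → Set} (P? : Decidable P) (xs : List A) →
    length (filter P? (reverse xs)) ≡ length (filter P? xs)
  length-filter-reverse P? [] = refl
  length-filter-reverse P? (x ∷ xs)
    rewrite unfold-reverse x xs | filter-++ P? (reverse xs) [ x ]
          | length-++ (filter P? (reverse xs)) {filter P? [ x ]} | length-filter-reverse P? xs
    with P? x
  ... | yes _ = +-comm _ 1
  ... | no _  = +-identityʳ _

-- Red neighbourhoods and blue cliques

Sorted : ∀ {N} → List (Fin N) → Set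
Sorted = AllPairs λ x y → toℕ x < toℕ y

allFin-sorted : ∀ N → Sorted (allFin N)
allFin-sorted N = AllPairsₚ.tabulate⁺-< id

increasing-witnesses : ∀ {N} {P : Fin N → Set} (P? : Decidable P) k → k ≤ length (filter P? (allFin N)) →
  Σ (Vector (Fin N) k) λ f → Increasing f × (∀ t → P (f t))
increasing-witnesses {N} P? k many with prefix-sequence _ (AllPairsₚ.filter⁺ P? (allFin-sorted N)) k many
... | f , f-incr , f∈ = f , f-incr , λ t → proj₂ (∈-filter⁻ P? {xs = allFin N} (f∈ t))

_≟ᶜ_ : (a b : Colour) → Dec (a ≡ b)
red  ≟ᶜ red  = yes refl
red  ≟ᶜ blue = no λ ()
blue ≟ᶜ red  = no λ ()
blue ≟ᶜ blue = yes refl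

module _ {N : ℕ} (c : Colouring N) where

  RedEdge : Fin N → Fin N → Set
  RedEdge x y = toℕ x < toℕ y × c x y ≡ red

  redEdge? : ∀ x y → Dec (RedEdge x y)
  redEdge? x y = (toℕ x <? toℕ y) ×-dec (c x y ≟ᶜ red)

  red-right-degree : Fin N → List (Fin N) → ℕ
  red-right-degree x B = length (filter (redEdge? x) B)

  red-left-degree : Fin N → List (Fin N) → ℕ
  red-left-degree x B = length (filter (λ y → redEdge? y x) B)

  blue-clique : ∀ n (zs : List (Fin N)) → AllPairs (λ x y → toℕ x < toℕ y × ¬ RedEdge x y) zs →
    suc n ≤ length zs → CopyIn N c blue (K (suc n))
  blue-clique n zs indep long with prefix-sequence zs indep (suc n) long
  ... | f , f-indep , _ = f , (λ i j i<j → proj₁ (f-indep i j i<j)) , λ i j (i<j , _) →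
    not-red (λ is-red → proj₂ (f-indep i j i<j) (proj₁ (f-indep i j i<j) , is-red))
    where
    not-red : ∀ {a} → ¬ a ≡ red → a ≡ blue
    not-red {red}  a≢red = ⊥-elim (a≢red refl)
    not-red {blue} _     = refl

  few-red-right⇒blue-clique : ∀ d n (B : List (Fin N)) → Sorted B →
    All (λ x → red-right-degree x B < d) B → d * n + 1 ≤ length B → CopyIn N c blue (K (suc n))
  few-red-right⇒blue-clique d n B sorted few long
    with greedy-independent redEdge? d n B sorted few long
  ... | zs , _ , long-zs , indep = blue-clique n zs indep long-zs

  few-red-left⇒blue-clique : ∀ d n (B : List (Fin N)) → Sorted B →
    All (λ x → red-left-degree x B < d) B → d * n + 1 ≤ length B → CopyIn N c blue (K (suc n))
  few-red-left⇒blue-clique d n B sorted few long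
    with greedy-independent (λ x y → redEdge? y x) d n (reverse B) (AllPairs-reverse sorted)
           (All-reverse (All.map (λ few-x → subst (_< d) (sym (length-filter-reverse _ B)) few-x) few))
           (subst (d * n + 1 ≤_) (sym (length-reverse B)) long)
  ... | zs , _ , long-zs , indep =
    blue-clique n (reverse zs) (AllPairs-reverse indep) (subst (suc n ≤_) (sym (length-reverse zs)) long-zs)

  RedToAfter : Fin N → Fin N → Fin N → Set
  RedToAfter w x y = toℕ x < toℕ y × RedEdge y w

  redToAfter? : ∀ w x → Decidable (RedToAfter w x)
  redToAfter? w x y = (toℕ x <? toℕ y) ×-dec redEdge? y w

  RedFromBefore : Fin N → Fin N → Fin N → Set
  RedFromBefore u x y = toℕ y < toℕ x × RedEdge u y

  redFromBefore? : ∀ u x → Decidable (RedFromBefore u x)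
  redFromBefore? u x y = (toℕ y <? toℕ x) ×-dec redEdge? u y

  -- the leftmost of k + 1 red left neighbours of w would satisfy P
  left-fans-short : (P : Fin N → Set) (k : ℕ) →
    (∀ u w → RedEdge u w → k ≤ length (filter (redToAfter? w u) (allFin N)) → P u) →
    ∀ w (F : List (Fin N)) → Sorted F → All (λ u → RedEdge u w) F → F ⊆ allFin N → All (¬_ ∘ P) F →
    length F < suc k
  left-fans-short P k fan⇒P w [] _ _ _ _ = s≤s z≤n
  left-fans-short P k fan⇒P w (u ∷ F) (u<F ∷ _) (uw ∷ Fw) sub (¬Pu ∷ _) with k ≤? length F
  ... | no short = s≤s (≰⇒> short)
  ... | yes long = ⊥-elim (¬Pu (fan⇒P u w uw
    (≤-trans long (length-≤-filter (redToAfter? w u) (All.zip (u<F , Fw)) (∷ˡ⁻ sub)))))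

  -- the rightmost of k + 1 red right neighbours of u would satisfy P
  right-fans-short : (P : Fin N → Set) (k : ℕ) →
    (∀ u t → RedEdge u t → k ≤ length (filter (redFromBefore? u t) (allFin N)) → P t) →
    ∀ u (F : List (Fin N)) → Sorted F → All (RedEdge u) F → F ⊆ allFin N → All (¬_ ∘ P) F →
    length F < suc k
  right-fans-short P k fan⇒P u F F-sorted F-red F⊆ F-¬P =
    subst (_< suc k) (length-reverse F) (from-the-right (reverse F) (AllPairs-reverse F-sorted)
      (All-reverse F-red) counted (All-reverse F-¬P))
    where
    counted : ∀ {Q} (Q? : Decidable Q) → length (filter Q? (reverse F)) ≤ length (filter Q? (allFin N))
    counted Q? = subst (_≤ _) (sym (length-filter-reverse Q? F)) (length-filter-mono Q? F⊆)
    from-the-right : ∀ D → AllPairs (λ x y → toℕ y < toℕ x) D → All (RedEdge u) D →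
      (∀ {Q} (Q? : Decidable Q) → length (filter Q? D) ≤ length (filter Q? (allFin N))) →
      All (¬_ ∘ P) D → length D < suc k
    from-the-right [] _ _ _ _ = s≤s z≤n
    from-the-right (t ∷ D) (D<t ∷ _) (ut ∷ uD) D-counted (¬Pt ∷ _) with k ≤? length D
    ... | no short = s≤s (≰⇒> short)
    ... | yes long = ⊥-elim (¬Pt (fan⇒P u t ut (≤-trans long (≤-trans
      (length-≤-filter (redFromBefore? u t) (All.zip (D<t , uD)) (t ∷ʳ ⊆-refl))
      (D-counted (redFromBefore? u t))))))

module _ {N} {R : Fin N → Fin N → Set} (R? : ∀ x → Decidable (R x)) (k : ℕ) where

  low-degree : List (Fin N)
  low-degree = filter (λ x → ¬? (k ≤? length (filter (R? x) (allFin N)))) (allFin N)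

  low-degree-sorted : Sorted low-degree
  low-degree-sorted = AllPairsₚ.filter⁺ _ (allFin-sorted N)

  low-degree-closed : All (λ x → length (filter (R? x) low-degree) < k) low-degree
  low-degree-closed = All.map
    (λ {x} x-low → ≤-<-trans (length-filter-mono (R? x) (filter-⊆ _ (allFin N))) (≰⇒> x-low))
    (Allₚ.all-filter _ (allFin N))

-- The lower bound

increasing-gap : ∀ k (f : Fin (suc k) → ℕ) → (∀ i j → toℕ i < toℕ j → f i < f j) →
  f fzero + k ≤ f (fromℕ k)
increasing-gap zero f incr = ≤-reflexive (+-identityʳ _)
increasing-gap (suc k) f incr = begin
    f fzero + suc k                ≡⟨ +-suc (f fzero) k ⟩
    suc (f fzero + k)              ≤⟨ s≤s (increasing-gap k (λ i → f (inject₁ i)) incr-inj) ⟩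
    suc (f (inject₁ (fromℕ k)))    ≤⟨ incr _ _ last-step ⟩
    f (fromℕ (suc k))              ∎
  where
  open ≤-Reasoning
  incr-inj : ∀ i j → toℕ i < toℕ j → f (inject₁ i) < f (inject₁ j)
  incr-inj i j i<j = incr _ _ (subst₂ _<_ (sym (toℕ-inject₁ i)) (sym (toℕ-inject₁ j)) i<j)
  last-step : toℕ (inject₁ (fromℕ k)) < toℕ (fromℕ (suc k))
  last-step = subst₂ _<_ (sym (trans (toℕ-inject₁ (fromℕ k)) (toℕ-fromℕ k))) (sym (toℕ-fromℕ (suc k))) ≤-refl

module BlockColouring (d : ℕ) .{{_ : NonZero d}} where

  block : ∀ {N} → Fin N → ℕ
  block x = toℕ x / d

  colouring : ∀ {N} → Colouring N
  colouring i j with block i ≟ block j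
  ... | yes _ = red
  ... | no _ = blue

  red⇒same-block : ∀ {N} (i j : Fin N) → colouring i j ≡ red → block i ≡ block j
  red⇒same-block i j _ with block i ≟ block j
  red⇒same-block i j _  | yes eq = eq
  red⇒same-block i j () | no _

  blue⇒other-block : ∀ {N} (i j : Fin N) → colouring i j ≡ blue → block i ≢ block j
  blue⇒other-block i j _ with block i ≟ block j
  blue⇒other-block i j () | yes _
  blue⇒other-block i j _  | no neq = neq

connected⇒¬arrows : ∀ {M} (J : OGraph M) → Connected J →
  ∀ n′ N → N < (M ∸ 1) * n′ + 1 → ¬ Arrows N J (K (suc n′))
connected⇒¬arrows {zero} J (() , _)
connected⇒¬arrows {suc M} J _ n′ zero _ arrows =
  Sum.[ (λ (φ , _) → ¬Fin0 (φ fzero)) , (λ (f , _) → ¬Fin0 (f fzero)) ] (arrows λ ())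
connected⇒¬arrows {suc zero} J _ n′ (suc N) (s≤s ())
connected⇒¬arrows {suc (suc d′)} J (_ , reach) n′ (suc N) N<bound arrows
  with arrows colouring
  where open BlockColouring (suc d′)
-- a red copy stays in one block but spans M − 1 = d consecutive positions
... | inj₁ (φ , φ-incr , φ-red) = <-irrefl refl (begin-strict
    block (φ fzero)                    <⟨ n<1+n _ ⟩
    suc (block (φ fzero))              ≡⟨ cong (λ x → suc (x / d)) (sym (m+n∸n≡m (toℕ (φ fzero)) d)) ⟩
    suc ((toℕ (φ fzero) + d ∸ d) / d)  ≡⟨ sym (m/n≡1+[m∸n]/n (m≤n+m d (toℕ (φ fzero)))) ⟩
    (toℕ (φ fzero) + d) / d            ≤⟨ /-monoˡ-≤ d (increasing-gap (suc d′) (λ i → toℕ (φ i)) φ-incr) ⟩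
    block (φ (fromℕ (suc d′)))         ≡⟨ same-block (reach (fromℕ (suc d′)) fzero) ⟩
    block (φ fzero)                    ∎)
  where
  open BlockColouring (suc d′)
  open ≤-Reasoning
  d : ℕ
  d = suc d′
  same-block : ∀ {i j} → Reach J i j → block (φ i) ≡ block (φ j)
  same-block here = refl
  same-block (step (inj₁ e) r) = trans (red⇒same-block _ _ (φ-red _ _ e)) (same-block r)
  same-block (step (inj₂ e) r) = trans (sym (red⇒same-block _ _ (φ-red _ _ e))) (same-block r)
... | inj₂ (f , f-incr , f-blue) = <⇒≱ last-block-small (≤-trans (m≤n+m n′ _) blocks-grow)
  where
  open BlockColouring (suc d′)
  blocks-grow : block (f fzero) + n′ ≤ block (f (fromℕ n′))
  blocks-grow = increasing-gap n′ (λ i → block (f i)) λ i j i<j →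
    ≤∧≢⇒< (/-monoˡ-≤ (suc d′) (<⇒≤ (f-incr i j i<j))) (blue⇒other-block _ _ (f-blue i j (i<j , refl)))
  last-block-small : block (f (fromℕ n′)) < n′
  last-block-small = m<n*o⇒m/o<n (<-≤-trans (toℕ<n (f (fromℕ n′)))
    (subst (suc N ≤_) (*-comm (suc d′) n′) (s≤s⁻¹ (subst (suc (suc N) ≤_) (+-comm _ 1) N<bound))))

-- Walks, joins and stars

module _ {m} {G : OGraph m} where

  adjacent-sym : ∀ {i j} → Adjacent G i j → Adjacent G j i
  adjacent-sym (inj₁ e) = inj₂ e
  adjacent-sym (inj₂ e) = inj₁ e

  reach-trans : ∀ {i j k} → Reach G i j → Reach G j k → Reach G i k
  reach-trans here r = r
  reach-trans (step a r) r′ = step a (reach-trans r r′)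

  reach-sym : ∀ {i j} → Reach G i j → Reach G j i
  reach-sym here = here
  reach-sym (step a r) = reach-trans (reach-sym r) (step (adjacent-sym a) here)

  connected-via-hub : 0 < m → (h : Fin m) → (∀ i → Reach G i h) → Connected G
  connected-via-hub 0<m h to-h = 0<m , λ i j → reach-trans (to-h i) (reach-sym (to-h j))

reach-map : ∀ {m k} {G : OGraph m} {H : OGraph k} (f : Fin m → Fin k) →
  (∀ i j → Edge G i j → Edge H (f i) (f j)) → ∀ {i j} → Reach G i j → Reach H (f i) (f j)
reach-map f f-edge here = here
reach-map f f-edge (step (inj₁ e) r) = step (inj₁ (f-edge _ _ e)) (reach-map f f-edge r)
reach-map f f-edge (step (inj₂ e) r) = step (inj₂ (f-edge _ _ e)) (reach-map f f-edge r)

module _ {m} (G : OGraph m) where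

  adjℕ-fromℕ< : ∀ {x y} (x<m : x < m) (y<m : y < m) → adjℕ G x y ≡ adj G (fromℕ< x<m) (fromℕ< y<m)
  adjℕ-fromℕ< {x} {y} x<m y<m with x <? m | y <? m
  ... | yes _   | yes _   = refl
  ... | no x≮m  | _       = ⊥-elim (x≮m x<m)
  ... | yes _   | no y≮m  = ⊥-elim (y≮m y<m)

  adjℕ-toℕ : ∀ i j → adjℕ G (toℕ i) (toℕ j) ≡ adj G i j
  adjℕ-toℕ i j = trans (adjℕ-fromℕ< (toℕ<n i) (toℕ<n j))
    (cong₂ (adj G) (fromℕ<-toℕ i (toℕ<n i)) (fromℕ<-toℕ j (toℕ<n j)))

module _ {m k : ℕ} (G : OGraph m) (H : OGraph k) where

  join-adj-left : ∀ i j (i<m : toℕ i < m) (j<m : toℕ j < m) →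
    adj (join G H) i j ≡ adj G (fromℕ< i<m) (fromℕ< j<m)
  join-adj-left i j i<m j<m with toℕ i <? m | toℕ j <? m
  ... | yes _   | yes _   = adjℕ-fromℕ< G i<m j<m
  ... | no i≮m  | _       = ⊥-elim (i≮m i<m)
  ... | yes _   | no j≮m  = ⊥-elim (j≮m j<m)

  join-adj-right : ∀ i j → m ∸ 1 ≤ toℕ i → m ≤ toℕ j →
    adj (join G H) i j ≡ adjℕ H (toℕ i ∸ (m ∸ 1)) (toℕ j ∸ (m ∸ 1))
  join-adj-right i j m-1≤i m≤j with toℕ i <? m | toℕ j <? m
  ... | _     | yes j<m = ⊥-elim (<⇒≱ j<m m≤j)
  ... | yes _ | no _ with (m ∸ 1) ≤? toℕ i | (m ∸ 1) ≤? toℕ j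
  ...   | yes _   | yes _  = refl
  ...   | no m-1≰i | _     = ⊥-elim (m-1≰i m-1≤i)
  ...   | yes _   | no m-1≰j = ⊥-elim (m-1≰j (≤-trans (m∸n≤m m 1) m≤j))
  join-adj-right i j m-1≤i m≤j | no _ | no _ with (m ∸ 1) ≤? toℕ i | (m ∸ 1) ≤? toℕ j
  ...   | yes _   | yes _  = refl
  ...   | no m-1≰i | _     = ⊥-elim (m-1≰i m-1≤i)
  ...   | yes _   | no m-1≰j = ⊥-elim (m-1≰j (≤-trans (m∸n≤m m 1) m≤j))

  join-adj-across : ∀ i j → toℕ i < m ∸ 1 → m ≤ toℕ j → adj (join G H) i j ≡ false
  join-adj-across i j i<m-1 m≤j with toℕ i <? m | toℕ j <? m
  ... | _     | yes j<m = ⊥-elim (<⇒≱ j<m m≤j)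
  ... | yes _ | no _ with (m ∸ 1) ≤? toℕ i
  ...   | yes m-1≤i = ⊥-elim (<⇒≱ i<m-1 m-1≤i)
  ...   | no _      = refl
  join-adj-across i j i<m-1 m≤j | no _ | no _ with (m ∸ 1) ≤? toℕ i
  ...   | yes m-1≤i = ⊥-elim (<⇒≱ i<m-1 m-1≤i)
  ...   | no _      = refl

  private
    left-bound : ∀ {x} → 0 < k → x < m → x < m + k ∸ 1
    left-bound {x} 0<k x<m = <-≤-trans x<m (subst (m ≤_) (sym (+-∸-assoc m 0<k)) (m≤m+n m (k ∸ 1)))

    right-bound : ∀ {y} → 0 < m → y < k → y + (m ∸ 1) < m + k ∸ 1
    right-bound {y} (s≤s {n = m′} _) y<k = subst (y + m′ <_) (+-comm k m′) (+-monoˡ-< m′ y<k)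

    m-1<m : 0 < m → m ∸ 1 < m
    m-1<m (s≤s _) = ≤-refl

    m-1≤ : ∀ {x} → m ≤ x → m ∸ 1 ≤ x
    m-1≤ = ≤-trans (m∸n≤m m 1)

    shifted-bound : ∀ {x} → 0 < m → m ∸ 1 ≤ x → x < m + k ∸ 1 → x ∸ (m ∸ 1) < k
    shifted-bound {x} (s≤s {n = m′} _) m′≤x x<m′+k = subst (x ∸ m′ <_) (m+n∸m≡n m′ k) (∸-monoˡ-< x<m′+k m′≤x)

  inject-left : 0 < k → Fin m → Fin (m + k ∸ 1)
  inject-left 0<k a = fromℕ< (left-bound 0<k (toℕ<n a))

  inject-right : 0 < m → Fin k → Fin (m + k ∸ 1)
  inject-right 0<m b = fromℕ< (right-bound 0<m (toℕ<n b))

  inject-left-edge : (0<k : 0 < k) → ∀ a b → Edge G a b →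
    Edge (join G H) (inject-left 0<k a) (inject-left 0<k b)
  inject-left-edge 0<k a b (a<b , ab) =
    subst₂ _<_ (sym (toℕ-fromℕ< _)) (sym (toℕ-fromℕ< _)) a<b ,
    trans (join-adj-left _ _ (toℕ<m a) (toℕ<m b)) (trans (cong₂ (adj G) (back a) (back b)) ab)
    where
    toℕ<m : ∀ a → toℕ (inject-left 0<k a) < m
    toℕ<m a = subst (_< m) (sym (toℕ-fromℕ< _)) (toℕ<n a)
    back : ∀ a → fromℕ< (toℕ<m a) ≡ a
    back a = toℕ-injective (trans (toℕ-fromℕ< _) (toℕ-fromℕ< _))

  inject-right-edge : (0<m : 0 < m) → ∀ a b → Edge H a b →
    Edge (join G H) (inject-right 0<m a) (inject-right 0<m b)
  inject-right-edge 0<m a b (a<b , ab) =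
    subst₂ _<_ (sym (toℕ-fromℕ< _)) (sym (toℕ-fromℕ< _)) (+-monoˡ-< (m ∸ 1) a<b) ,
    (begin
      adj (join G H) (inject-right 0<m a) (inject-right 0<m b)
        ≡⟨ join-adj-right _ _ (subst (m ∸ 1 ≤_) (sym (toℕ-fromℕ< _)) (m≤n+m _ (toℕ a))) m≤b ⟩
      adjℕ H (toℕ (inject-right 0<m a) ∸ (m ∸ 1)) (toℕ (inject-right 0<m b) ∸ (m ∸ 1))
        ≡⟨ cong₂ (adjℕ H) (unshift a) (unshift b) ⟩
      adjℕ H (toℕ a) (toℕ b)
        ≡⟨ adjℕ-toℕ H a b ⟩
      adj H a b
        ≡⟨ ab ⟩
      true ∎)
    where
    open ≡-Reasoning
    unshift : ∀ a → toℕ (inject-right 0<m a) ∸ (m ∸ 1) ≡ toℕ a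
    unshift a = trans (cong (_∸ (m ∸ 1)) (toℕ-fromℕ< _)) (m+n∸n≡m (toℕ a) (m ∸ 1))
    m≤b : m ≤ toℕ (inject-right 0<m b)
    m≤b = subst (m ≤_) (sym (toℕ-fromℕ< _))
      (subst (_≤ toℕ b + (m ∸ 1)) (trans (+-comm 1 (m ∸ 1)) (m∸n+n≡m 0<m))
        (+-monoˡ-≤ (m ∸ 1) (≤-trans (s≤s z≤n) a<b)))

  join-connected : Connected G → Connected H → Connected (join G H)
  join-connected (0<m , G-reach) (0<k , H-reach) =
    connected-via-hub (≤-<-trans z≤n (toℕ<n hub)) hub to-hub
    where
    G-last : Fin m
    G-last = fromℕ< (m-1<m 0<m)
    H-first : Fin k
    H-first = fromℕ< 0<k
    hub : Fin (m + k ∸ 1)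
    hub = inject-left 0<k G-last
    hub-right : inject-right 0<m H-first ≡ hub
    hub-right = toℕ-injective (trans (toℕ-fromℕ< _) (trans (cong (_+ (m ∸ 1)) (toℕ-fromℕ< 0<k))
      (sym (trans (toℕ-fromℕ< _) (toℕ-fromℕ< _)))))
    to-hub : ∀ i → Reach (join G H) i hub
    to-hub i with toℕ i <? m
    ... | yes i<m = subst (λ z → Reach (join G H) z hub)
        (toℕ-injective (trans (toℕ-fromℕ< _) (toℕ-fromℕ< i<m)))
      (reach-map (inject-left 0<k) (inject-left-edge 0<k) (G-reach (fromℕ< i<m) G-last))
    ... | no i≮m = subst₂ (Reach (join G H)) (toℕ-injective (trans (toℕ-fromℕ< _) (trans
        (cong (_+ (m ∸ 1)) (toℕ-fromℕ< i′<k)) (m∸n+n≡m m-1≤i)))) hub-right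
      (reach-map (inject-right 0<m) (inject-right-edge 0<m) (H-reach (fromℕ< i′<k) H-first))
      where
      m-1≤i : m ∸ 1 ≤ toℕ i
      m-1≤i = m-1≤ (≮⇒≥ i≮m)
      i′<k : toℕ i ∸ (m ∸ 1) < k
      i′<k = shifted-bound 0<m m-1≤i (toℕ<n i)

  copy-join : ∀ {N} {c : Colouring N} {col} (φ : CopyIn N c col G) (χ : CopyIn N c col H)
    (a : Fin m) (b : Fin k) → toℕ a ≡ m ∸ 1 → toℕ b ≡ 0 → proj₁ φ a ≡ proj₁ χ b →
    CopyIn N c col (join G H)
  copy-join {N} {c} {col} (φ , φ-incr , φ-col) (χ , χ-incr , χ-col) a b a-last b-first φa≡χb =
    glue , glue-incr , glue-col
    where
    0<m = ≤-<-trans z≤n (toℕ<n a)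

    right : ∀ i → m ∸ 1 ≤ toℕ i → Fin k
    right i m-1≤i = fromℕ< (shifted-bound 0<m m-1≤i (toℕ<n i))

    glue : Fin (m + k ∸ 1) → Fin N
    glue i with toℕ i <? m
    ... | yes i<m = φ (fromℕ< i<m)
    ... | no i≮m  = χ (right i (m-1≤ (≮⇒≥ i≮m)))

    glue-left : ∀ i (i<m : toℕ i < m) → glue i ≡ φ (fromℕ< i<m)
    glue-left i i<m with toℕ i <? m
    ... | yes _   = refl
    ... | no i≮m  = ⊥-elim (i≮m i<m)

    -- the shared vertex m − 1 lies in both halves, which agree there
    glue-right : ∀ i (m-1≤i : m ∸ 1 ≤ toℕ i) → glue i ≡ χ (right i m-1≤i)
    glue-right i m-1≤i with toℕ i <? m
    ... | no _    = refl
    ... | yes i<m = trans (cong φ (toℕ-injective (trans (toℕ-fromℕ< i<m) (trans i≡m-1 (sym a-last)))))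
                   (trans φa≡χb (cong χ (toℕ-injective (trans b-first (sym (trans (toℕ-fromℕ< _)
                     (trans (cong (_∸ (m ∸ 1)) i≡m-1) (n∸n≡0 (m ∸ 1)))))))))
      where
      i≡m-1 : toℕ i ≡ m ∸ 1
      i≡m-1 = ≤-antisym (<⇒≤pred i<m) m-1≤i

    right-< : ∀ i j (m-1≤i : m ∸ 1 ≤ toℕ i) (m-1≤j : m ∸ 1 ≤ toℕ j) → toℕ i < toℕ j →
      toℕ (right i m-1≤i) < toℕ (right j m-1≤j)
    right-< i j m-1≤i _ i<j = subst₂ _<_ (sym (toℕ-fromℕ< _)) (sym (toℕ-fromℕ< _)) (∸-monoˡ-< i<j m-1≤i)

    left-< : ∀ i j (i<m : toℕ i < m) (j<m : toℕ j < m) → toℕ i < toℕ j → toℕ (fromℕ< i<m) < toℕ (fromℕ< j<m)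
    left-< i j i<m j<m i<j = subst₂ _<_ (sym (toℕ-fromℕ< i<m)) (sym (toℕ-fromℕ< j<m)) i<j

    glue-incr : Increasing glue
    glue-incr i j i<j with m ≤? toℕ j | m ∸ 1 ≤? toℕ i
    ... | no m≰j | _ = subst₂ (λ x y → toℕ x < toℕ y) (sym (glue-left i i<m)) (sym (glue-left j j<m))
                          (φ-incr _ _ (left-< i j i<m j<m i<j))
      where
      j<m : toℕ j < m
      j<m = ≰⇒> m≰j
      i<m : toℕ i < m
      i<m = <-trans i<j j<m
    ... | yes m≤j | yes m-1≤i =
      subst₂ (λ x y → toℕ x < toℕ y) (sym (glue-right i m-1≤i)) (sym (glue-right j (m-1≤ m≤j)))
        (χ-incr _ _ (right-< i j m-1≤i (m-1≤ m≤j) i<j))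
    ... | yes m≤j | no i≱m-1 =
      subst₂ (λ x y → toℕ x < toℕ y) (sym (glue-left i i<m)) (sym (glue-right j m-1≤j))
        (begin-strict
          toℕ (φ (fromℕ< i<m)) <⟨ φ-incr _ a (subst₂ _<_ (sym (toℕ-fromℕ< i<m)) (sym a-last) (≰⇒> i≱m-1)) ⟩
          toℕ (φ a)            ≡⟨ cong toℕ φa≡χb ⟩
          toℕ (χ b)            <⟨ χ-incr b _ (subst₂ _<_ (sym b-first) (sym (toℕ-fromℕ< _))
                                    (m<n⇒0<n∸m (<-≤-trans (m-1<m 0<m) m≤j))) ⟩
          toℕ (χ (right j m-1≤j)) ∎)
      where
      open ≤-Reasoning
      i<m : toℕ i < m
      i<m = <-≤-trans (≰⇒> i≱m-1) (m∸n≤m m 1)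
      m-1≤j : m ∸ 1 ≤ toℕ j
      m-1≤j = m-1≤ m≤j

    glue-col : ∀ i j → Edge (join G H) i j → c (glue i) (glue j) ≡ col
    glue-col i j (i<j , ij) with m ≤? toℕ j | m ∸ 1 ≤? toℕ i
    ... | no m≰j | _ = subst₂ (λ x y → c x y ≡ col) (sym (glue-left i i<m)) (sym (glue-left j j<m))
                          (φ-col _ _ (left-< i j i<m j<m i<j , trans (sym (join-adj-left i j i<m j<m)) ij))
      where
      j<m : toℕ j < m
      j<m = ≰⇒> m≰j
      i<m : toℕ i < m
      i<m = <-trans i<j j<m
    ... | yes m≤j | yes m-1≤i =
      subst₂ (λ x y → c x y ≡ col) (sym (glue-right i m-1≤i)) (sym (glue-right j m-1≤j))
        (χ-col _ _ (right-< i j m-1≤i m-1≤j i<j , (begin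
          adj H (right i m-1≤i) (right j m-1≤j)
            ≡⟨ sym (adjℕ-fromℕ< H (shifted-bound 0<m m-1≤i (toℕ<n i)) (shifted-bound 0<m m-1≤j (toℕ<n j))) ⟩
          adjℕ H (toℕ i ∸ (m ∸ 1)) (toℕ j ∸ (m ∸ 1))           ≡⟨ sym (join-adj-right i j m-1≤i m≤j) ⟩
          adj (join G H) i j                                    ≡⟨ ij ⟩
          true                                                  ∎)))
      where
      open ≡-Reasoning
      m-1≤j : m ∸ 1 ≤ toℕ j
      m-1≤j = m-1≤ m≤j
    ... | yes m≤j | no i≱m-1 with () ← trans (sym (join-adj-across i j (≰⇒> i≱m-1) m≤j)) ij

module _ (l r : ℕ) where

  star-edge⁻ : ∀ {i j} → Edge (Star l r) i j → toℕ i ≡ l ∸ 1 ⊎ toℕ j ≡ l ∸ 1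
  star-edge⁻ (_ , ij) = Sum.map (≡ᵇ⇒≡ _ _) (≡ᵇ⇒≡ _ _) (Equivalence.to T-∨ (Equivalence.from T-≡ ij))

  star-edge⁺ : ∀ {i j} → toℕ i < toℕ j → toℕ i ≡ l ∸ 1 ⊎ toℕ j ≡ l ∸ 1 → Edge (Star l r) i j
  star-edge⁺ i<j centre = i<j , Equivalence.to T-≡ (Equivalence.from T-∨ (Sum.map (≡⇒≡ᵇ _ _) (≡⇒≡ᵇ _ _) centre))

  star-connected : 0 < l → 0 < r → Connected (Star l r)
  star-connected (s≤s {n = l′} _) (s≤s {n = r′} _) =
    connected-via-hub (≤-<-trans z≤n (toℕ<n centre)) centre to-centre
    where
    centre : Fin (l + r ∸ 1)
    centre = fromℕ< (subst (l′ <_) (sym (+-suc l′ r′)) (s≤s (m≤m+n l′ r′)))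
    toℕ-centre : toℕ centre ≡ l′
    toℕ-centre = toℕ-fromℕ< _
    to-centre : ∀ i → Reach (Star l r) i centre
    to-centre i with <-cmp (toℕ i) l′
    ... | tri< i<c _ _ = step (inj₁ (star-edge⁺ (subst (toℕ i <_) (sym toℕ-centre) i<c) (inj₂ toℕ-centre))) here
    ... | tri≈ _ i≡c _ =
      subst (λ z → Reach (Star l r) z centre) (toℕ-injective (trans toℕ-centre (sym i≡c))) here
    ... | tri> _ _ c<i = step (inj₂ (star-edge⁺ (subst (_< toℕ i) (sym toℕ-centre) c<i) (inj₁ toℕ-centre))) here

module _ {N : ℕ} where

  ∷-increasing : ∀ {k} (x : Fin N) (f : Vector (Fin N) k) → (∀ t → toℕ x < toℕ (f t)) →
    Increasing f → Increasing (x Vector.∷ f)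
  ∷-increasing x f x<f f-incr fzero    (fsuc j) _         = x<f j
  ∷-increasing x f x<f f-incr (fsuc i) (fsuc j) (s≤s i<j) = f-incr i j i<j

  data Split (a : ℕ) {b : ℕ} : Fin (a + b) → Set where
    left  : (s : Fin a) → Split a (s ↑ˡ b)
    right : (t : Fin b) → Split a (a ↑ʳ t)

  split : ∀ a {b} (i : Fin (a + b)) → Split a i
  split a i with splitAt a i in eq
  ... | inj₁ s = subst (Split a) (splitAt⁻¹-↑ˡ eq) (left s)
  ... | inj₂ t = subst (Split a) (splitAt⁻¹-↑ʳ eq) (right t)

  ++-increasing : ∀ {a b} (f : Vector (Fin N) a) (g : Vector (Fin N) b) → Increasing f → Increasing g →
    (∀ s t → toℕ (f s) < toℕ (g t)) → Increasing (f ++ g)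
  ++-increasing {a} {b} f g f-incr g-incr f<g i j i<j with split a i | split a j
  ... | left s  | left s′  rewrite lookup-++ˡ f g s | lookup-++ˡ f g s′ =
    f-incr s s′ (subst₂ _<_ (toℕ-↑ˡ s b) (toℕ-↑ˡ s′ b) i<j)
  ... | left s  | right t  rewrite lookup-++ˡ f g s | lookup-++ʳ f g t = f<g s t
  ... | right t | left s   = ⊥-elim (<-asym i<j (subst₂ _<_ (sym (toℕ-↑ˡ s b)) (sym (toℕ-↑ʳ a t))
                               (<-≤-trans (toℕ<n s) (m≤m+n a (toℕ t)))))
  ... | right t | right t′ rewrite lookup-++ʳ f g t | lookup-++ʳ f g t′ =
    g-incr t t′ (+-cancelˡ-< a _ _ (subst₂ _<_ (toℕ-↑ʳ a t) (toℕ-↑ʳ a t′) i<j))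

  ++-all : ∀ {a b} {P : Fin N → Set} (f : Vector (Fin N) a) (g : Vector (Fin N) b) →
    (∀ s → P (f s)) → (∀ t → P (g t)) → ∀ i → P ((f ++ g) i)
  ++-all {a} {P = P} f g f-P g-P i with split a i
  ... | left s  = subst P (sym (lookup-++ˡ f g s)) (f-P s)
  ... | right t = subst P (sym (lookup-++ʳ f g t)) (g-P t)

  module _ {a b : ℕ} (L : Vector (Fin N) a) (x : Fin N) (R : Vector (Fin N) b) where

    private
      at-centre : ∀ i → toℕ i ≡ a → (L ++ (x Vector.∷ R)) i ≡ x
      at-centre i i≡a with split a i
      ... | left s         = ⊥-elim (<-irrefl (trans (sym (toℕ-↑ˡ s (suc b))) i≡a) (toℕ<n s))
      ... | right fzero    = lookup-++ʳ L _ fzero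
      ... | right (fsuc t) =
        ⊥-elim (m≢1+m+n a (trans (sym i≡a) (trans (toℕ-↑ʳ a (fsuc t)) (+-suc a (toℕ t)))))

      left-of-centre : ∀ i → toℕ i < a → Σ (Fin a) λ s → (L ++ (x Vector.∷ R)) i ≡ L s
      left-of-centre i i<a = fromℕ< i<a , lookup-++-< L _ i i<a

      right-of-centre : ∀ i → a < toℕ i → Σ (Fin b) λ t → (L ++ (x Vector.∷ R)) i ≡ R t
      right-of-centre i a<i with split a i
      ... | left s         = ⊥-elim (<-asym a<i (subst (_< a) (sym (toℕ-↑ˡ s (suc b))) (toℕ<n s)))
      ... | right fzero    = ⊥-elim (<-irrefl (sym (trans (toℕ-↑ʳ a fzero) (+-identityʳ a))) a<i)
      ... | right (fsuc t) = t , lookup-++ʳ L _ (fsuc t)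

    star-copy : ∀ {c : Colouring N} {col} → Increasing L → Increasing R →
      (∀ s → toℕ (L s) < toℕ x) → (∀ t → toℕ x < toℕ (R t)) →
      (∀ s → c (L s) x ≡ col) → (∀ t → c x (R t) ≡ col) →
      IsCopy c col (Star (suc a) (suc b)) (L ++ (x Vector.∷ R))
    star-copy {c} {col} L-incr R-incr L<x x<R L-col R-col =
      ++-increasing L _ L-incr (∷-increasing x R x<R R-incr) L<x∷R , edge-col
      where
      L<x∷R : ∀ s t → toℕ (L s) < toℕ ((x Vector.∷ R) t)
      L<x∷R s fzero    = L<x s
      L<x∷R s (fsuc t) = <-trans (L<x s) (x<R t)
      edge-col : ∀ i j → Edge (Star (suc a) (suc b)) i j →
        c ((L ++ (x Vector.∷ R)) i) ((L ++ (x Vector.∷ R)) j) ≡ col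
      edge-col i j e@(i<j , _) with star-edge⁻ (suc a) (suc b) e
      ... | inj₁ i≡a with right-of-centre j (subst (_< toℕ j) i≡a i<j)
      ...   | t , j↦Rt rewrite at-centre i i≡a | j↦Rt = R-col t
      edge-col i j e@(i<j , _) | inj₂ j≡a with left-of-centre i (subst (toℕ i <_) j≡a i<j)
      ...   | s , i↦Ls rewrite at-centre j j≡a | i↦Ls = L-col s

-- The extension argument

arrows-via-extension : ∀ {m M} (m′ n′ a : ℕ) {G : OGraph m} {J : OGraph M} (v : Fin m)
  (Ext : ∀ {N} → Colouring N → Fin N → Set) (Ext? : ∀ {N} (c : Colouring N) → Decidable (Ext c)) →
  Arrows (m′ * n′ + 1) G (K (suc n′)) →
  (∀ {N} (c : Colouring N) → a * n′ + 1 ≤ length (filter (¬? ∘ Ext? c) (allFin N)) →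
     CopyIn N c blue (K (suc n′))) →
  (∀ {N} (c : Colouring N) (φ : CopyIn N c red G) → Ext c (proj₁ φ v) → CopyIn N c red J) →
  Arrows ((m′ + a) * n′ + 1) J (K (suc n′))
arrows-via-extension m′ n′ a v Ext Ext? G-arrows few-extendable extend c
  with a * n′ + 1 ≤? length (filter (¬? ∘ Ext? c) (allFin _))
... | yes many-stuck = inj₂ (few-extendable c many-stuck)
... | no few-stuck with increasing-witnesses (Ext? c) (m′ * n′ + 1) many-extendable
  where
  N : ℕ
  N = (m′ + a) * n′ + 1
  extendable : List (Fin N)
  extendable = filter (Ext? c) (allFin N)
  many-extendable : m′ * n′ + 1 ≤ length extendable
  many-extendable = +-cancelʳ-≤ _ _ _ (begin
      m′ * n′ + 1 + length stuck   ≤⟨ +-monoʳ-≤ (m′ * n′ + 1) few-stuck′ ⟩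
      m′ * n′ + 1 + a * n′         ≡⟨ rearrange ⟩
      (m′ + a) * n′ + 1            ≡⟨ sym (length-tabulate {n = N} id) ⟩
      length (allFin N)            ≡⟨ length-filter-split (Ext? c) (allFin N) ⟩
      length extendable + length stuck ∎)
    where
    open ≤-Reasoning
    stuck : List (Fin N)
    stuck = filter (¬? ∘ Ext? c) (allFin N)
    few-stuck′ : length stuck ≤ a * n′
    few-stuck′ = s≤s⁻¹ (subst (suc (length stuck) ≤_) (+-comm (a * n′) 1) (≰⇒> few-stuck))
    rearrange : m′ * n′ + 1 + a * n′ ≡ (m′ + a) * n′ + 1
    rearrange = eq m′ n′ a
      where
      eq : ∀ m n a → m * n + 1 + a * n ≡ (m + a) * n + 1
      eq = solve-∀
... | σ , σ-incr , σ-ext with G-arrows (λ i j → c (σ i) (σ j))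
...   | inj₁ φ = inj₁ (extend c (copy-along-increasing {c = c} σ σ-incr φ) (σ-ext (proj₁ φ v)))
...   | inj₂ f = inj₂ (copy-along-increasing {c = c} σ σ-incr f)

ngood-via-extension : ∀ {m M} (m′ n′ a : ℕ) {G : OGraph m} {J : OGraph M} (v : Fin m) →
  Connected J → m′ + a ≡ M ∸ 1 →
  (Ext : ∀ {N} → Colouring N → Fin N → Set) (Ext? : ∀ {N} (c : Colouring N) → Decidable (Ext c)) →
  Arrows (m′ * n′ + 1) G (K (suc n′)) →
  (∀ {N} (c : Colouring N) → a * n′ + 1 ≤ length (filter (¬? ∘ Ext? c) (allFin N)) →
     CopyIn N c blue (K (suc n′))) →
  (∀ {N} (c : Colouring N) (φ : CopyIn N c red G) → Ext c (proj₁ φ v) → CopyIn N c red J) →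
  NGood (suc n′) J
ngood-via-extension m′ n′ a {J = J} v J-connected size Ext Ext? G-arrows stuck⇒clique extend =
  J-connected ,
  subst (λ z → Arrows (z * n′ + 1) J (K (suc n′))) size
    (arrows-via-extension m′ n′ a v Ext Ext? G-arrows stuck⇒clique extend) ,
  λ N N<R → connected⇒¬arrows J J-connected n′ N N<R

module _ {n′ m′ : ℕ} (G : OGraph (suc m′)) (G-good : NGood (suc n′) G) where

  private
    G-arrows : Arrows (m′ * n′ + 1) G (K (suc n′))
    G-arrows = proj₁ (proj₂ G-good)

  join-Star[1,1+r]-good : ∀ r′ → NGood (suc n′) (join G (Star 1 (suc r′)))
  join-Star[1,1+r]-good r′ = ngood-via-extension m′ n′ r′ (fromℕ m′)
    (join-connected G S (proj₁ G-good) (star-connected 1 (suc r′) (s≤s z≤n) (s≤s z≤n)))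
    (sym (cong pred (+-suc m′ r′))) Ext Ext? G-arrows stuck⇒clique extend
    where
    S : OGraph (suc r′)
    S = Star 1 (suc r′)
    J : OGraph (m′ + suc r′)
    J = join G S
    Ext : ∀ {N} → Colouring N → Fin N → Set
    Ext c x = r′ ≤ red-right-degree c x (allFin _)
    Ext? : ∀ {N} (c : Colouring N) → Decidable (Ext c)
    Ext? c x = r′ ≤? red-right-degree c x (allFin _)
    stuck⇒clique : ∀ {N} (c : Colouring N) → r′ * n′ + 1 ≤ length (filter (¬? ∘ Ext? c) (allFin N)) →
      CopyIn N c blue (K (suc n′))
    stuck⇒clique c = few-red-right⇒blue-clique c r′ n′ _ (low-degree-sorted (redEdge? c) r′)
      (low-degree-closed (redEdge? c) r′)
    extend : ∀ {N} (c : Colouring N) (φ : CopyIn N c red G) → Ext c (proj₁ φ (fromℕ m′)) → CopyIn N c red J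
    extend c φ ext with increasing-witnesses (redEdge? c x) r′ ext
      where x = proj₁ φ (fromℕ m′)
    ... | R , R-incr , R-red = copy-join G S {c = c} φ
      (_ , star-copy Vector.[] _ R {c = c} (λ ()) R-incr (λ ()) (proj₁ ∘ R-red) (λ ()) (proj₂ ∘ R-red))
      (fromℕ m′) fzero (toℕ-fromℕ m′) refl refl

  Star[1+l,1]-join-good : ∀ l′ → NGood (suc n′) (join (Star (suc l′) 1) G)
  Star[1+l,1]-join-good l′ = ngood-via-extension m′ n′ l′ fzero
    (join-connected S G (star-connected (suc l′) 1 (s≤s z≤n) (s≤s z≤n)) (proj₁ G-good))
    size Ext Ext? G-arrows stuck⇒clique extend
    where
    S : OGraph (l′ + 1)
    S = Star (suc l′) 1
    J : OGraph (l′ + 1 + suc m′ ∸ 1)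
    J = join S G
    size : m′ + l′ ≡ l′ + 1 + suc m′ ∸ 1 ∸ 1
    size = cong (λ z → z ∸ 1 ∸ 1) (eq l′ m′)
      where
      eq : ∀ l m → suc (suc (m + l)) ≡ l + 1 + suc m
      eq = solve-∀
    Ext : ∀ {N} → Colouring N → Fin N → Set
    Ext c x = l′ ≤ red-left-degree c x (allFin _)
    Ext? : ∀ {N} (c : Colouring N) → Decidable (Ext c)
    Ext? c x = l′ ≤? red-left-degree c x (allFin _)
    stuck⇒clique : ∀ {N} (c : Colouring N) → l′ * n′ + 1 ≤ length (filter (¬? ∘ Ext? c) (allFin N)) →
      CopyIn N c blue (K (suc n′))
    stuck⇒clique c = few-red-left⇒blue-clique c l′ n′ _ (low-degree-sorted (λ x y → redEdge? c y x) l′)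
      (low-degree-closed (λ x y → redEdge? c y x) l′)
    extend : ∀ {N} (c : Colouring N) (φ : CopyIn N c red G) → Ext c (proj₁ φ fzero) → CopyIn N c red J
    extend c φ ext with increasing-witnesses (λ y → redEdge? c y x) l′ ext
      where x = proj₁ φ fzero
    ... | L , L-incr , L-red = copy-join S G {c = c}
      (_ , star-copy L _ Vector.[] {c = c} L-incr (λ ()) (proj₁ ∘ L-red) (λ ()) (proj₂ ∘ L-red) (λ ()))
      φ (l′ ↑ʳ fzero) fzero (trans (toℕ-↑ʳ l′ fzero) (trans (+-identityʳ l′) (sym (m+n∸n≡m l′ 1)))) refl
      (lookup-++ʳ L _ fzero)

  join-Star[2+l,1]-good : ∀ l″ → NGood (suc n′) (join G (Star (suc (suc l″)) 1))
  join-Star[2+l,1]-good l″ = ngood-via-extension m′ n′ (suc l″) (fromℕ m′)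
    (join-connected G S (proj₁ G-good) (star-connected (suc (suc l″)) 1 (s≤s z≤n) (s≤s z≤n)))
    size Ext Ext? G-arrows stuck⇒clique extend
    where
    S : OGraph (suc (l″ + 1))
    S = Star (suc (suc l″)) 1
    J : OGraph (m′ + suc (l″ + 1))
    J = join G S
    size : m′ + suc l″ ≡ m′ + suc (l″ + 1) ∸ 1
    size = cong pred (eq m′ l″)
      where
      eq : ∀ m l → suc (m + suc l) ≡ m + suc (l + 1)
      eq = solve-∀
    -- x extends through a centre w joined in red to x and to l″ vertices between x and w
    Ext : ∀ {N} → Colouring N → Fin N → Set
    Ext c x = Any (λ w → RedEdge c x w × l″ ≤ length (filter (redToAfter? c w x) (allFin _))) (allFin _)
    Ext? : ∀ {N} (c : Colouring N) → Decidable (Ext c)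
    Ext? c x = any? (λ w → redEdge? c x w ×-dec (l″ ≤? length (filter (redToAfter? c w x) (allFin _)))) (allFin _)
    stuck⇒clique : ∀ {N} (c : Colouring N) → suc l″ * n′ + 1 ≤ length (filter (¬? ∘ Ext? c) (allFin N)) →
      CopyIn N c blue (K (suc n′))
    stuck⇒clique {N} c = few-red-left⇒blue-clique c (suc l″) n′ B B-sorted (All.universal short B)
      where
      B : List (Fin N)
      B = filter (¬? ∘ Ext? c) (allFin N)
      B-sorted : Sorted B
      B-sorted = AllPairsₚ.filter⁺ _ (allFin-sorted N)
      short : ∀ w → red-left-degree c w B < suc l″
      short w = left-fans-short c (Ext c) l″ (λ u w uw many → lose (∈-allFin w) (uw , many)) w _
        (AllPairsₚ.filter⁺ _ B-sorted) (Allₚ.all-filter _ B)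
        (⊆-trans (filter-⊆ _ B) (filter-⊆ _ (allFin N))) (Allₚ.filter⁺ _ (Allₚ.all-filter _ (allFin N)))
    extend : ∀ {N} (c : Colouring N) (φ : CopyIn N c red G) → Ext c (proj₁ φ (fromℕ m′)) → CopyIn N c red J
    extend c φ ext with Any.satisfied ext
    ... | w , xw , many-inner with increasing-witnesses (redToAfter? c w x) l″ many-inner
      where x = proj₁ φ (fromℕ m′)
    ...   | ε , ε-incr , ε-inner = copy-join G S {c = c} φ
      (_ , star-copy (x Vector.∷ ε) w Vector.[] {c = c} (∷-increasing x ε (proj₁ ∘ ε-inner) ε-incr) (λ ())
        L<w (λ ()) L-red (λ ()))
      (fromℕ m′) fzero (toℕ-fromℕ m′) refl refl
      where
      x = proj₁ φ (fromℕ m′)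
      L<w : ∀ s → toℕ ((x Vector.∷ ε) s) < toℕ w
      L<w fzero    = proj₁ xw
      L<w (fsuc t) = proj₁ (proj₂ (ε-inner t))
      L-red : ∀ s → c ((x Vector.∷ ε) s) w ≡ red
      L-red fzero    = proj₂ xw
      L-red (fsuc t) = proj₂ (proj₂ (ε-inner t))

  Star[1,2+r]-join-good : ∀ r″ → NGood (suc n′) (join (Star 1 (suc (suc r″))) G)
  -- the leaves come as the vector ε ++ [x] of length r″ + 1, hence Star 1 (suc (r″ + 1)) below
  Star[1,2+r]-join-good r″ = subst (λ r → NGood (suc n′) (join (Star 1 (suc r)) G)) (+-comm r″ 1)
    (ngood-via-extension m′ n′ (suc r″) fzero
      (join-connected S G (star-connected 1 (suc (r″ + 1)) (s≤s z≤n) (s≤s z≤n)) (proj₁ G-good))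
      size Ext Ext? G-arrows stuck⇒clique extend)
    where
    S : OGraph (suc (r″ + 1))
    S = Star 1 (suc (r″ + 1))
    J : OGraph (r″ + 1 + suc m′)
    J = join S G
    size : m′ + suc r″ ≡ r″ + 1 + suc m′ ∸ 1
    size = cong pred (eq m′ r″)
      where
      eq : ∀ m r → suc (m + suc r) ≡ r + 1 + suc m
      eq = solve-∀
    -- x extends through a centre u joined in red to x and to r″ vertices between u and x
    Ext : ∀ {N} → Colouring N → Fin N → Set
    Ext c x = Any (λ u → RedEdge c u x × r″ ≤ length (filter (redFromBefore? c u x) (allFin _))) (allFin _)
    Ext? : ∀ {N} (c : Colouring N) → Decidable (Ext c)
    Ext? c x = any? (λ u → redEdge? c u x ×-dec (r″ ≤? length (filter (redFromBefore? c u x) (allFin _)))) (allFin _)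
    stuck⇒clique : ∀ {N} (c : Colouring N) → suc r″ * n′ + 1 ≤ length (filter (¬? ∘ Ext? c) (allFin N)) →
      CopyIn N c blue (K (suc n′))
    stuck⇒clique {N} c = few-red-right⇒blue-clique c (suc r″) n′ B B-sorted (All.universal short B)
      where
      B : List (Fin N)
      B = filter (¬? ∘ Ext? c) (allFin N)
      B-sorted : Sorted B
      B-sorted = AllPairsₚ.filter⁺ _ (allFin-sorted N)
      short : ∀ u → red-right-degree c u B < suc r″
      short u = right-fans-short c (Ext c) r″ (λ u t ut many → lose (∈-allFin u) (ut , many)) u _
        (AllPairsₚ.filter⁺ _ B-sorted) (Allₚ.all-filter _ B)
        (⊆-trans (filter-⊆ _ B) (filter-⊆ _ (allFin N))) (Allₚ.filter⁺ _ (Allₚ.all-filter _ (allFin N)))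
    extend : ∀ {N} (c : Colouring N) (φ : CopyIn N c red G) → Ext c (proj₁ φ fzero) → CopyIn N c red J
    extend c φ ext with Any.satisfied ext
    ... | u , ux , many-inner with increasing-witnesses (redFromBefore? c u x) r″ many-inner
      where x = proj₁ φ fzero
    ...   | ε , ε-incr , ε-inner = copy-join S G {c = c}
      (_ , star-copy Vector.[] u R {c = c} (λ ()) R-incr (λ ()) u<R (λ ()) R-red)
      φ (fsuc (r″ ↑ʳ fzero)) fzero
      (trans (cong suc (trans (toℕ-↑ʳ r″ fzero) (+-identityʳ r″))) (+-comm 1 r″)) refl
      (lookup-++ʳ ε _ fzero)
      where
      x = proj₁ φ fzero
      R = ε ++ (x Vector.∷ Vector.[])
      R-incr : Increasing R
      R-incr = ++-increasing ε _ ε-incr (λ { fzero fzero () }) λ { s fzero → proj₁ (ε-inner s) }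
      u<R : ∀ t → toℕ u < toℕ (R t)
      u<R = ++-all {P = λ y → toℕ u < toℕ y} ε _ (λ s → proj₁ (proj₂ (ε-inner s))) λ { fzero → proj₁ ux }
      R-red : ∀ t → c u (R t) ≡ red
      R-red = ++-all {P = λ y → c u y ≡ red} ε _ (λ s → proj₂ (proj₂ (ε-inner s))) λ { fzero → proj₂ ux }

theorem12 : (n r l m : ℕ) → 1 ≤ n → 1 ≤ r → 1 ≤ l → (G : OGraph m) →
    NGood n G →
    NGood n (join G (Star 1 r)) × NGood n (join G (Star l 1)) ×
    NGood n (join (Star l 1) G) × NGood n (join (Star 1 r) G)
theorem12 n r l zero _ _ _ G ((() , _) , _)
theorem12 (suc n′) (suc r′) (suc l′) (suc m′) _ _ _ G good =
  join-Star[1,1+r]-good G good r′ , join-Star[1+l,1]-good l′ ,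
  Star[1+l,1]-join-good G good l′ , Star[1,1+r]-join-good r′
  where
  join-Star[1+l,1]-good : ∀ l′ → NGood (suc n′) (join G (Star (suc l′) 1))
  join-Star[1+l,1]-good zero     = join-Star[1,1+r]-good G good 0
  join-Star[1+l,1]-good (suc l″) = join-Star[2+l,1]-good G good l″
  Star[1,1+r]-join-good : ∀ r′ → NGood (suc n′) (join (Star 1 (suc r′)) G)
  Star[1,1+r]-join-good zero     = Star[1+l,1]-join-good G good 0
  Star[1,1+r]-join-good (suc r″) = Star[1,2+r]-join-good G good r″
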